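{- Let $s,t$ be positive integers with $\min\{s,t\}\ge 2$, and let $M$ be an $(s,t)$-spike of order $m\ge\max\{3s+t,\,s+3t\}-4$. Then $M$ is $(2\min\{s,t\}-1)$-connected.
   Context: For positive integers $s,t$, an $(s,t)$-spike of order $m$ is a matroid $M$ with $m\ge\max\{s,t\}$ together with a partition $(A_1,\dots,A_m)$ of $E(M)$ into $2$-element sets (the arms) such that the union of any $s$ of the $A_i$ is a circuit of $M$ and the union of any $t$ of the $A_i$ is a cocircuit of $M$. The connectivity function of $M$ is $\lambda(X)=r(X)+r(E(M)-X)-r(M)$ for $X\subseteq E(M)$. For a positive integer $k$, a $k$-separation of $M$ is a partition $(X,Y)$ of $E(M)$ with $|X|,|Y|\ge k$ and $\lambda(X)<k$; $M$ is $n$-connected if it has no $k$-separation for any $k<n$. -}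

module Defs where

open import Data.Nat using (ℕ; suc; _+_; _∸_; _≤_; _<_; _⊔_)
open import Data.Fin using (Fin)
open import Data.Fin.Subset using (Subset; _⊆_; _⊂_; _∪_; _∩_; ∁; ⊤; ∣_∣; ⁅_⁆)
open import Data.Vec using (tabulate; lookup)
open import Data.Product using (_×_)
open import Relation.Nullary using (¬_)
open import Relation.Binary.PropositionalEquality using (_≡_)

record Matroid (n : ℕ) : Set where
  field
    r      : Subset n → ℕ
    r-bound : ∀ X → r X ≤ ∣ X ∣
    r-mono  : ∀ {X Y} → X ⊆ Y → r X ≤ r Y
    r-sub   : ∀ X Y → r (X ∪ Y) + r (X ∩ Y) ≤ r X + r Y

module _ {n : ℕ} (M : Matroid n) where
  open Matroid M

  IsCircuit : Subset n → Set
  IsCircuit C = (r C < ∣ C ∣) × (∀ X → X ⊂ C → r X ≡ ∣ X ∣)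

  r* : Subset n → ℕ
  r* X = ∣ X ∣ + r (∁ X) ∸ r ⊤

  IsCocircuit : Subset n → Set
  IsCocircuit C = (r* C < ∣ C ∣) × (∀ X → X ⊂ C → r* X ≡ ∣ X ∣)

  conn : Subset n → ℕ
  conn X = r X + r (∁ X) ∸ r ⊤

  IsSeparation : ℕ → Subset n → Set
  IsSeparation k X = (k ≤ ∣ X ∣) × (k ≤ ∣ ∁ X ∣) × (conn X < k)

  IsConnected : ℕ → Set
  IsConnected N = ∀ k → 1 ≤ k → k < N → ∀ X → ¬ IsSeparation k X

-- Arms are encoded by a map arm : E → Fin m; the arm A_i is the fibre
-- arm⁻¹(i). Requiring every fibre to have exactly 2 elements makes
-- (A_1, ..., A_m) a partition of E into 2-element sets.
armsUnion : {n m : ℕ} → (Fin n → Fin m) → Subset m → Subset n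
armsUnion arm S = tabulate (λ e → lookup S (arm e))

record IsSpike {n : ℕ} (M : Matroid n) (s t m : ℕ) (arm : Fin n → Fin m) : Set where
  field
    order     : s ⊔ t ≤ m
    armsSize  : ∀ i → ∣ armsUnion arm ⁅ i ⁆ ∣ ≡ 2
    circuits  : ∀ S → ∣ S ∣ ≡ s → IsCircuit M (armsUnion arm S)
    cocircuits : ∀ S → ∣ S ∣ ≡ t → IsCocircuit M (armsUnion arm S)

-- Let (X, Y) be a k-separation and sort the arms by how many of their two elements lie in X:
-- a arms lie in X, b in Y and c are split, so a + b + c = m, |X| ≤ 2a + c and |Y| ≤ 2b + c.
-- Complementing a t-arm cocircuit shows r(E) ≤ m - t + s, since a union of u ≥ s arms has rank
-- below u + s (each arm beyond an s-arm circuit adds at most one). Conversely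
-- r(X) ≥ min(a + c, m - t + 1) + min(a, s - 1): in a part of X spread over at most m - t + 1
-- arms, an element of a split arm is a coloop, because a t-arm cocircuit through its arm avoids
-- all other arms of that part; the first s - 1 full arms are independent, and each further full
-- arm still adds one. With m ≥ 3s + t - 4 these bounds give λ(X) ≥ k by a case analysis.
module Submission where

open import Data.Bool using (Bool; true; false; not; _∧_; _xor_)
open import Data.Bool.Properties using (∧-conicalˡ; ∧-conicalʳ; xor-annihilates-not)
open import Data.Fin using (Fin; zero; suc; _≟_)
open import Data.Fin.Subset
open import Data.Fin.Subset.Properties
open import Data.List using (_∷_; [])
open import Data.Nat using (ℕ; zero; suc; _+_; _*_; _∸_; _≤_; _<_; _⊓_; _⊔_; _≤?_; s≤s; z≤n)
open import Data.Nat.Properties hiding (_≟_)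
open import Data.Nat.Tactic.RingSolver using (solve)
open import Algebra.Properties.CommutativeSemigroup +-commutativeSemigroup using (interchange; xy∙z≈xz∙y)
open import Data.Product using (_×_; _,_; proj₁; proj₂; ∃-syntax)
open import Data.Sum using (_⊎_; inj₁; inj₂)
open import Data.Vec using (tabulate; lookup; here; there)
open import Data.Vec.Properties using (lookup∘tabulate; lookup-map; tabulate-cong; []=⇒lookup; lookup⇒[]=)
open import Function using (_∘_; _∘′_)
open import Relation.Binary.PropositionalEquality
open import Relation.Nullary using (yes; no; contradiction)
open import Defs

private variable
  n k : ℕ
  p q : Subset n
  x y : Fin n

-- Finite subsets

Disjoint : Subset n → Subset n → Set
Disjoint p q = ∀ {x} → x ∈ p → x ∉ q

x∈tabulate⁺ : ∀ {f : Fin n → Bool} → f x ≡ true → x ∈ tabulate f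
x∈tabulate⁺ {x = x} {f} fx = lookup⇒[]= x (tabulate f) (trans (lookup∘tabulate f x) fx)

x∈tabulate⁻ : ∀ {f : Fin n → Bool} → x ∈ tabulate f → f x ≡ true
x∈tabulate⁻ {x = x} {f} x∈ = trans (sym (lookup∘tabulate f x)) ([]=⇒lookup x∈)

x≡y⇒x∈⁅y⁆ : x ≡ y → x ∈ ⁅ y ⁆
x≡y⇒x∈⁅y⁆ {x = x} refl = x∈⁅x⁆ x

x∈p-y⇒x∈p : x ∈ p - y → x ∈ p
x∈p-y⇒x∈p {y = y} = p─q⊆p _ ⁅ y ⁆

-- Vec's _∷_ and [] are kept local: next to List's they make the ring solver's variable lists
-- below ambiguous, which slows elaboration down enormously.
module _ where
  open import Data.Vec using (_∷_; [])

  x∈p-y⇒x≢y : x ∈ p - y → x ≢ y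
  x∈p-y⇒x≢y {p = _ ∷ _} {y = zero}  ()          refl
  x∈p-y⇒x≢y {p = _ ∷ _} {y = suc y} (there x∈) refl = x∈p-y⇒x≢y x∈ refl

  x∈p⇒∣p∣≡1+∣p-x∣ : x ∈ p → ∣ p ∣ ≡ suc ∣ p - x ∣
  x∈p⇒∣p∣≡1+∣p-x∣ {p = inside  ∷ p} here        = cong (suc ∘′ ∣_∣) (sym (p─⊥≡p p))
  x∈p⇒∣p∣≡1+∣p-x∣ {p = inside  ∷ p} (there x∈p) = cong suc (x∈p⇒∣p∣≡1+∣p-x∣ x∈p)
  x∈p⇒∣p∣≡1+∣p-x∣ {p = outside ∷ p} (there x∈p) = x∈p⇒∣p∣≡1+∣p-x∣ x∈p

  ∣p∪q∣≤∣p∣+∣q∣ : ∀ (p q : Subset n) → ∣ p ∪ q ∣ ≤ ∣ p ∣ + ∣ q ∣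
  ∣p∪q∣≤∣p∣+∣q∣ []            []            = z≤n
  ∣p∪q∣≤∣p∣+∣q∣ (inside  ∷ p) (inside  ∷ q) =
    s≤s (≤-trans (∣p∪q∣≤∣p∣+∣q∣ p q) (+-monoʳ-≤ ∣ p ∣ (n≤1+n ∣ q ∣)))
  ∣p∪q∣≤∣p∣+∣q∣ (inside  ∷ p) (outside ∷ q) = s≤s (∣p∪q∣≤∣p∣+∣q∣ p q)
  ∣p∪q∣≤∣p∣+∣q∣ (outside ∷ p) (inside  ∷ q) =
    ≤-trans (s≤s (∣p∪q∣≤∣p∣+∣q∣ p q)) (≤-reflexive (sym (+-suc ∣ p ∣ ∣ q ∣)))
  ∣p∪q∣≤∣p∣+∣q∣ (outside ∷ p) (outside ∷ q) = ∣p∪q∣≤∣p∣+∣q∣ p q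

  drop-∷-Disjoint : ∀ {b c} → Disjoint (b ∷ p) (c ∷ q) → Disjoint p q
  drop-∷-Disjoint p#q x∈p x∈q = p#q (there x∈p) (there x∈q)

  ∣p∪q∣≡∣p∣+∣q∣ : ∀ (p q : Subset n) → Disjoint p q → ∣ p ∪ q ∣ ≡ ∣ p ∣ + ∣ q ∣
  ∣p∪q∣≡∣p∣+∣q∣ []            []            _ = refl
  ∣p∪q∣≡∣p∣+∣q∣ (inside  ∷ p) (inside  ∷ q) p#q = contradiction here (p#q here)
  ∣p∪q∣≡∣p∣+∣q∣ (inside  ∷ p) (outside ∷ q) p#q = cong suc (∣p∪q∣≡∣p∣+∣q∣ p q (drop-∷-Disjoint p#q))
  ∣p∪q∣≡∣p∣+∣q∣ (outside ∷ p) (inside  ∷ q) p#q =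
    trans (cong suc (∣p∪q∣≡∣p∣+∣q∣ p q (drop-∷-Disjoint p#q))) (sym (+-suc ∣ p ∣ ∣ q ∣))
  ∣p∪q∣≡∣p∣+∣q∣ (outside ∷ p) (outside ∷ q) p#q = ∣p∪q∣≡∣p∣+∣q∣ p q (drop-∷-Disjoint p#q)

  subset-of-size : ∀ (p : Subset n) → k ≤ ∣ p ∣ → ∃[ q ] q ⊆ p × ∣ q ∣ ≡ k
  subset-of-size {n} {k = zero} p _ = ⊥ , (λ x∈⊥ → contradiction x∈⊥ ∉⊥) , ∣⊥∣≡0 n
  subset-of-size {k = suc k} (inside ∷ p) (s≤s k≤∣p∣) =
    let q , q⊆p , ∣q∣≡k = subset-of-size p k≤∣p∣ in inside ∷ q , in⊆in q⊆p , cong suc ∣q∣≡k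
  subset-of-size {k = suc k} (outside ∷ p) k≤∣p∣ =
    let q , q⊆p , ∣q∣≡k = subset-of-size p k≤∣p∣ in outside ∷ q , s⊆s q⊆p , ∣q∣≡k

x∈p∧∣p∣≡1+k⇒∣p-x∣≡k : x ∈ p → ∣ p ∣ ≡ suc k → ∣ p - x ∣ ≡ k
x∈p∧∣p∣≡1+k⇒∣p-x∣≡k x∈p ∣p∣≡1+k = suc-injective (trans (sym (x∈p⇒∣p∣≡1+∣p-x∣ x∈p)) ∣p∣≡1+k)

x∈p⇒0<∣p∣ : x ∈ p → 0 < ∣ p ∣
x∈p⇒0<∣p∣ x∈p = ≤-trans (s≤s z≤n) (x∈p⇒∣p-x∣<∣p∣ x∈p)

∣p∣+∣∁p∣≡n : ∀ (p : Subset n) → ∣ p ∣ + ∣ ∁ p ∣ ≡ n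
∣p∣+∣∁p∣≡n p = trans (cong (∣ p ∣ +_) (∣∁p∣≡n∸∣p∣ p)) (m+[n∸m]≡n (∣p∣≤n p))

0<∣p∣⇒Nonempty : 0 < ∣ p ∣ → Nonempty p
0<∣p∣⇒Nonempty {n} {p} 0<∣p∣ with nonempty? p
... | yes p≢∅ = p≢∅
... | no  p≡∅ = contradiction (trans (cong ∣_∣ (Empty-unique p≡∅)) (∣⊥∣≡0 n)) (>⇒≢ 0<∣p∣)

∣p∣≡1+k⇒Nonempty : ∣ p ∣ ≡ suc k → Nonempty p
∣p∣≡1+k⇒Nonempty ∣p∣≡1+k = 0<∣p∣⇒Nonempty (≤-trans (s≤s z≤n) (≤-reflexive (sym ∣p∣≡1+k)))

disjoint-subset-of-size : ∀ (p : Subset n) → ∣ p ∣ + k ≤ n → ∃[ q ] Disjoint p q × ∣ q ∣ ≡ k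
disjoint-subset-of-size {n} {k} p ∣p∣+k≤n
  with subset-of-size (∁ p) (+-cancelˡ-≤ ∣ p ∣ k (∣ ∁ p ∣) (≤-trans ∣p∣+k≤n (≤-reflexive (sym (∣p∣+∣∁p∣≡n p)))))
... | q , q⊆∁p , ∣q∣≡k = q , (λ x∈p x∈q → x∈∁p⇒x∉p (q⊆∁p x∈q) x∈p) , ∣q∣≡k

record Doubleton (p : Subset n) : Set where
  field
    fst snd  : Fin n
    fst∈     : fst ∈ p
    snd∈     : snd ∈ p
    fst≢snd  : fst ≢ snd
    elements : x ∈ p → x ≡ fst ⊎ x ≡ snd

∣p∣≡2⇒Doubleton : ∣ p ∣ ≡ 2 → Doubleton p
∣p∣≡2⇒Doubleton {n} {p} ∣p∣≡2 with ∣p∣≡1+k⇒Nonempty ∣p∣≡2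
... | u , u∈p with ∣p∣≡1+k⇒Nonempty {p = p - u} (x∈p∧∣p∣≡1+k⇒∣p-x∣≡k u∈p ∣p∣≡2)
...   | v , v∈p-u = record
  { fst = u ; snd = v ; fst∈ = u∈p ; snd∈ = x∈p-y⇒x∈p v∈p-u
  ; fst≢snd = λ u≡v → x∈p-y⇒x≢y v∈p-u (sym u≡v) ; elements = elements }
  where
  ∣p-u-v∣≡0 : ∣ p - u - v ∣ ≡ 0
  ∣p-u-v∣≡0 = x∈p∧∣p∣≡1+k⇒∣p-x∣≡k {p = p - u} v∈p-u (x∈p∧∣p∣≡1+k⇒∣p-x∣≡k u∈p ∣p∣≡2)
  elements : ∀ {z} → z ∈ p → z ≡ u ⊎ z ≡ v
  elements {z} z∈p with z ≟ u | z ≟ v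
  ... | yes z≡u | _       = inj₁ z≡u
  ... | no _    | yes z≡v = inj₂ z≡v
  ... | no z≢u  | no z≢v  =
    contradiction ∣p-u-v∣≡0 (>⇒≢ (x∈p⇒0<∣p∣ (x∈p∧x≢y⇒x∈p-y (x∈p∧x≢y⇒x∈p-y z∈p z≢u) z≢v)))

-- Preimages

module Preimage {n m : ℕ} (f : Fin n → Fin m) where

  private
    U : Subset m → Subset n
    U = armsUnion f

  x∈armsUnion⁺ : ∀ {x S} → f x ∈ S → x ∈ U S
  x∈armsUnion⁺ = x∈tabulate⁺ ∘ []=⇒lookup

  x∈armsUnion⁻ : ∀ S {x} → x ∈ U S → f x ∈ S
  x∈armsUnion⁻ S {x} = lookup⇒[]= (f x) S ∘ x∈tabulate⁻

  armsUnion-split : ∀ P {Q i} → i ∈ Q → P ∩ U Q ≡ (P ∩ U (Q - i)) ∪ (P ∩ U ⁅ i ⁆)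
  armsUnion-split P {Q} {i} i∈Q = ⊆-antisym ⊆∪ ∪⊆
    where
    ⊆∪ : P ∩ U Q ⊆ (P ∩ U (Q - i)) ∪ (P ∩ U ⁅ i ⁆)
    ⊆∪ {x} x∈ with x∈p∩q⁻ P (U Q) x∈ | f x ≟ i
    ... | x∈P , _   | yes fx≡i = x∈p∪q⁺ (inj₂ (x∈p∩q⁺ (x∈P , x∈armsUnion⁺ (x≡y⇒x∈⁅y⁆ fx≡i))))
    ... | x∈P , x∈U | no fx≢i  =
      x∈p∪q⁺ (inj₁ (x∈p∩q⁺ (x∈P , x∈armsUnion⁺ (x∈p∧x≢y⇒x∈p-y (x∈armsUnion⁻ Q x∈U) fx≢i))))
    ∪⊆ : (P ∩ U (Q - i)) ∪ (P ∩ U ⁅ i ⁆) ⊆ P ∩ U Q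
    ∪⊆ {x} x∈ with x∈p∪q⁻ _ _ x∈
    ... | inj₁ x∈₁ = let x∈P , x∈U = x∈p∩q⁻ P _ x∈₁ in
      x∈p∩q⁺ (x∈P , x∈armsUnion⁺ (x∈p-y⇒x∈p (x∈armsUnion⁻ (Q - i) x∈U)))
    ... | inj₂ x∈₂ = let x∈P , x∈U = x∈p∩q⁻ P _ x∈₂ in
      x∈p∩q⁺ (x∈P , x∈armsUnion⁺ (subst (_∈ Q) (sym (x∈⁅y⁆⇒x≡y i (x∈armsUnion⁻ ⁅ i ⁆ x∈U))) i∈Q))

  armsUnion-split-disjoint : ∀ P Q i → Disjoint (P ∩ U (Q - i)) (P ∩ U ⁅ i ⁆)
  armsUnion-split-disjoint P Q i x∈₁ x∈₂ =
    x∈p-y⇒x≢y (x∈armsUnion⁻ (Q - i) (proj₂ (x∈p∩q⁻ P _ x∈₁)))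
              (x∈⁅y⁆⇒x≡y i (x∈armsUnion⁻ ⁅ i ⁆ (proj₂ (x∈p∩q⁻ P _ x∈₂))))

  ∣P∩armsUnion∣ : ∀ {w} (P : Subset n) (Q : Subset m) → (∀ {i} → i ∈ Q → ∣ P ∩ U ⁅ i ⁆ ∣ ≡ w) →
                  ∣ P ∩ U Q ∣ ≡ ∣ Q ∣ * w
  ∣P∩armsUnion∣ {w} P Q fibre = count ∣ Q ∣ Q refl fibre
    where
    count : ∀ k Q → ∣ Q ∣ ≡ k → (∀ {i} → i ∈ Q → ∣ P ∩ U ⁅ i ⁆ ∣ ≡ w) → ∣ P ∩ U Q ∣ ≡ k * w
    count zero Q ∣Q∣≡0 _ = trans (cong ∣_∣ (Empty-unique P∩UQ≡∅)) (∣⊥∣≡0 n)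
      where
      P∩UQ≡∅ : Empty (P ∩ U Q)
      P∩UQ≡∅ (x , x∈) = contradiction ∣Q∣≡0 (>⇒≢ (x∈p⇒0<∣p∣ (x∈armsUnion⁻ Q (proj₂ (x∈p∩q⁻ P (U Q) x∈)))))
    count (suc k) Q ∣Q∣≡1+k fibre with ∣p∣≡1+k⇒Nonempty ∣Q∣≡1+k
    ... | i , i∈Q = begin
      ∣ P ∩ U Q ∣                             ≡⟨ cong ∣_∣ (armsUnion-split P i∈Q) ⟩
      ∣ (P ∩ U (Q - i)) ∪ (P ∩ U ⁅ i ⁆) ∣     ≡⟨ ∣p∪q∣≡∣p∣+∣q∣ _ _ (armsUnion-split-disjoint P Q i) ⟩
      ∣ P ∩ U (Q - i) ∣ + ∣ P ∩ U ⁅ i ⁆ ∣     ≡⟨ cong₂ _+_ (count k (Q - i) ∣Q-i∣≡k (fibre ∘ x∈p-y⇒x∈p)) (fibre i∈Q) ⟩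
      k * w + w                               ≡⟨ +-comm (k * w) w ⟩
      suc k * w                               ∎
      where
      open ≡-Reasoning
      ∣Q-i∣≡k : ∣ Q - i ∣ ≡ k
      ∣Q-i∣≡k = x∈p∧∣p∣≡1+k⇒∣p-x∣≡k i∈Q ∣Q∣≡1+k

-- Inequalities between natural numbers

⊓-capped-+ : ∀ a c L → a ⊓ L + c ⊓ (L ∸ a ⊓ L) ≡ (a + c) ⊓ L
⊓-capped-+ a c L = begin
  a ⊓ L + c ⊓ (L ∸ a ⊓ L)           ≡⟨ +-distribˡ-⊓ (a ⊓ L) c (L ∸ a ⊓ L) ⟩
  (a ⊓ L + c) ⊓ (a ⊓ L + (L ∸ a ⊓ L)) ≡⟨ cong₂ _⊓_ (+-distribʳ-⊓ c a L) (m+[n∸m]≡n (m⊓n≤n a L)) ⟩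
  (a + c) ⊓ (L + c) ⊓ L             ≡⟨ ⊓-assoc (a + c) (L + c) L ⟩
  (a + c) ⊓ ((L + c) ⊓ L)           ≡⟨ cong ((a + c) ⊓_) (m≥n⇒m⊓n≡n (m≤m+n L c)) ⟩
  (a + c) ⊓ L                       ∎
  where open ≡-Reasoning

⊓-absorbs-≤ : ∀ a {σ L} → σ ≤ L → (a ⊓ L) ⊓ σ ≡ a ⊓ σ
⊓-absorbs-≤ a {σ} {L} σ≤L = trans (⊓-assoc a L σ) (cong (a ⊓_) (m≥n⇒m⊓n≡n σ≤L))

private
  2*-split : ∀ σ → 2 * σ ≡ σ + σ
  2*-split σ = cong (σ +_) (+-identityʳ σ)

k≤σ+τ : ∀ {k σ τ} → k ≤ 2 * σ → k ≤ 2 * τ → k ≤ σ + τ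
k≤σ+τ {k} {σ} {τ} k≤2σ k≤2τ with ≤-total σ τ
... | inj₁ σ≤τ = ≤-trans k≤2σ (≤-trans (≤-reflexive (2*-split σ)) (+-monoʳ-≤ σ σ≤τ))
... | inj₂ τ≤σ = ≤-trans k≤2τ (≤-trans (≤-reflexive (2*-split τ)) (+-monoˡ-≤ τ τ≤σ))

k+σ≤L : ∀ {k σ L} → 3 * σ ≤ L → k ≤ 2 * σ → k + σ ≤ L
k+σ≤L {k} {σ} {L} 3σ≤L k≤2σ = begin
  k + σ       ≤⟨ +-monoˡ-≤ σ k≤2σ ⟩
  2 * σ + σ   ≡⟨ solve (σ ∷ []) ⟩
  3 * σ       ≤⟨ 3σ≤L ⟩
  L           ∎
  where open ≤-Reasoning

weight-bound : ∀ {k a c σ} → k ≤ a * 2 + c → k ≤ 2 * σ → k ≤ a + c + a ⊓ σ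
weight-bound {k} {a} {c} {σ} k≤2a+c k≤2σ with ≤-total a σ
... | inj₁ a≤σ = begin
  k                ≤⟨ k≤2a+c ⟩
  a * 2 + c        ≡⟨ solve (a ∷ c ∷ []) ⟩
  a + c + a        ≡⟨ cong (a + c +_) (m≤n⇒m⊓n≡m a≤σ) ⟨
  a + c + a ⊓ σ    ∎
  where open ≤-Reasoning
... | inj₂ σ≤a = begin
  k                ≤⟨ k≤2σ ⟩
  2 * σ            ≡⟨ 2*-split σ ⟩
  σ + σ            ≤⟨ +-monoˡ-≤ σ (≤-trans σ≤a (m≤m+n a c)) ⟩
  a + c + σ        ≡⟨ cong (a + c +_) (m≥n⇒m⊓n≡n σ≤a) ⟨
  a + c + a ⊓ σ    ∎
  where open ≤-Reasoning

-- A side of the separation with a full and c half arms is short when a + c ≤ L.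
module _ {k σ τ L a b c : ℕ} (3σ≤L : 3 * σ ≤ L) (L+τ≤a+b+c : L + τ ≤ a + b + c) (k≤2σ : k ≤ 2 * σ) where

  private
    k+σ≤a+b+c : k + σ ≤ a + b + c
    k+σ≤a+b+c = ≤-trans (k+σ≤L 3σ≤L k≤2σ) (≤-trans (m≤m+n L τ) L+τ≤a+b+c)

  short-long : k ≤ a * 2 + c → k + (L + σ) ≤ (a + c + a ⊓ σ) + (L + b ⊓ σ)
  short-long k≤2a+c with ≤-total σ b
  ... | inj₁ σ≤b = begin
    k + (L + σ)                   ≤⟨ +-monoˡ-≤ (L + σ) (weight-bound {k} {a} {c} {σ} k≤2a+c k≤2σ) ⟩
    (a + c + a ⊓ σ) + (L + σ)     ≡⟨ cong (λ x → a + c + a ⊓ σ + (L + x)) (m≥n⇒m⊓n≡n σ≤b) ⟨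
    (a + c + a ⊓ σ) + (L + b ⊓ σ) ∎
    where open ≤-Reasoning
  ... | inj₂ b≤σ = begin
    k + (L + σ)                   ≡⟨ solve (k ∷ L ∷ σ ∷ []) ⟩
    k + σ + L                     ≤⟨ +-monoˡ-≤ L k+σ≤a+b+c ⟩
    a + b + c + L                 ≡⟨ solve (a ∷ b ∷ c ∷ L ∷ []) ⟩
    a + c + (L + b)               ≤⟨ +-monoˡ-≤ (L + b) (m≤m+n (a + c) (a ⊓ σ)) ⟩
    (a + c + a ⊓ σ) + (L + b)     ≡⟨ cong (λ x → a + c + a ⊓ σ + (L + x)) (m≤n⇒m⊓n≡m b≤σ) ⟨
    (a + c + a ⊓ σ) + (L + b ⊓ σ) ∎
    where open ≤-Reasoning

  short-short : k ≤ 2 * τ → a + c ≤ L → b + c ≤ L → k + (L + σ) ≤ (a + c + a ⊓ σ) + (b + c + b ⊓ σ)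
  short-short k≤2τ a+c≤L b+c≤L = begin
    k + (L + σ)                           ≡⟨ solve (k ∷ L ∷ σ ∷ []) ⟩
    L + (k + σ)                           ≤⟨ +-monoʳ-≤ L key ⟩
    L + (τ + c + a ⊓ σ + b ⊓ σ)           ≡⟨ rearrange₁ L τ c (a ⊓ σ) (b ⊓ σ) ⟩
    L + τ + (c + a ⊓ σ + b ⊓ σ)           ≤⟨ +-monoˡ-≤ (c + a ⊓ σ + b ⊓ σ) L+τ≤a+b+c ⟩
    a + b + c + (c + a ⊓ σ + b ⊓ σ)       ≡⟨ rearrange₂ a b c (a ⊓ σ) (b ⊓ σ) ⟩
    (a + c + a ⊓ σ) + (b + c + b ⊓ σ)     ∎
    where
    open ≤-Reasoning
    rearrange₁ : ∀ L τ c x y → L + (τ + c + x + y) ≡ L + τ + (c + x + y)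
    rearrange₁ L τ c x y = solve (L ∷ τ ∷ c ∷ x ∷ y ∷ [])
    rearrange₂ : ∀ a b c x y → a + b + c + (c + x + y) ≡ (a + c + x) + (b + c + y)
    rearrange₂ a b c x y = solve (a ∷ b ∷ c ∷ x ∷ y ∷ [])
    -- Both sides have at least t - 1 full arms, since a + b + c ≥ L + τ.
    τ≤a : τ ≤ a
    τ≤a = +-cancelʳ-≤ L τ a (begin
      τ + L         ≡⟨ +-comm τ L ⟩
      L + τ         ≤⟨ L+τ≤a+b+c ⟩
      a + b + c     ≡⟨ +-assoc a b c ⟩
      a + (b + c)   ≤⟨ +-monoʳ-≤ a b+c≤L ⟩
      a + L         ∎)
    τ≤b : τ ≤ b
    τ≤b = +-cancelʳ-≤ L τ b (begin
      τ + L         ≡⟨ +-comm τ L ⟩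
      L + τ         ≤⟨ L+τ≤a+b+c ⟩
      a + b + c     ≡⟨ solve (a ∷ b ∷ c ∷ []) ⟩
      b + (a + c)   ≤⟨ +-monoʳ-≤ b a+c≤L ⟩
      b + L         ∎)
    k≤τ+x : ∀ {x} → τ ≤ x → k ≤ τ + x
    k≤τ+x τ≤x = ≤-trans k≤2τ (≤-trans (≤-reflexive (2*-split τ)) (+-monoʳ-≤ τ τ≤x))
    key : k + σ ≤ τ + c + a ⊓ σ + b ⊓ σ
    key with ≤-total a σ | ≤-total b σ
    ... | inj₁ a≤σ | inj₁ b≤σ rewrite m≤n⇒m⊓n≡m a≤σ | m≤n⇒m⊓n≡m b≤σ = begin
      k + σ           ≤⟨ k+σ≤a+b+c ⟩
      a + b + c       ≤⟨ m≤n+m (a + b + c) τ ⟩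
      τ + (a + b + c) ≡⟨ solve (τ ∷ a ∷ b ∷ c ∷ []) ⟩
      τ + c + a + b   ∎
    ... | inj₁ a≤σ | inj₂ σ≤b rewrite m≤n⇒m⊓n≡m a≤σ | m≥n⇒m⊓n≡n σ≤b = begin
      k + σ           ≤⟨ +-monoˡ-≤ σ (≤-trans (k≤τ+x τ≤a) (+-monoˡ-≤ a (m≤m+n τ c))) ⟩
      τ + c + a + σ   ∎
    ... | inj₂ σ≤a | inj₁ b≤σ rewrite m≥n⇒m⊓n≡n σ≤a | m≤n⇒m⊓n≡m b≤σ = begin
      k + σ           ≤⟨ +-monoˡ-≤ σ (≤-trans (k≤τ+x τ≤b) (+-monoˡ-≤ b (m≤m+n τ c))) ⟩
      τ + c + b + σ   ≡⟨ solve (τ ∷ c ∷ b ∷ σ ∷ []) ⟩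
      τ + c + σ + b   ∎
    ... | inj₂ σ≤a | inj₂ σ≤b rewrite m≥n⇒m⊓n≡n σ≤a | m≥n⇒m⊓n≡n σ≤b = begin
      k + σ           ≤⟨ +-monoˡ-≤ σ (k≤σ+τ {k} {σ} {τ} k≤2σ k≤2τ) ⟩
      σ + τ + σ       ≤⟨ +-monoˡ-≤ σ (≤-trans (≤-reflexive (+-comm σ τ)) (m≤m+n (τ + σ) c)) ⟩
      τ + σ + c + σ   ≡⟨ solve (τ ∷ σ ∷ c ∷ []) ⟩
      τ + c + σ + σ   ∎

separation-inequality : ∀ {k σ τ L a b c} → 3 * σ ≤ L → L + τ ≤ a + b + c → k ≤ 2 * σ → k ≤ 2 * τ →
                        k ≤ a * 2 + c → k ≤ b * 2 + c →
                        k + (L + σ) ≤ ((a + c) ⊓ L + a ⊓ σ) + ((b + c) ⊓ L + b ⊓ σ)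
separation-inequality {k} {σ} {τ} {L} {a} {b} {c} 3σ≤L L+τ≤a+b+c k≤2σ k≤2τ k≤2a+c k≤2b+c
  with ≤-total (a + c) L | ≤-total (b + c) L
... | inj₁ a+c≤L | inj₁ b+c≤L rewrite m≤n⇒m⊓n≡m a+c≤L | m≤n⇒m⊓n≡m b+c≤L =
  short-short {k} {σ} {τ} {L} {a} {b} {c} 3σ≤L L+τ≤a+b+c k≤2σ k≤2τ a+c≤L b+c≤L
... | inj₁ a+c≤L | inj₂ L≤b+c rewrite m≤n⇒m⊓n≡m a+c≤L | m≥n⇒m⊓n≡n L≤b+c =
  short-long {k} {σ} {τ} {L} {a} {b} {c} 3σ≤L L+τ≤a+b+c k≤2σ k≤2a+c
... | inj₂ L≤a+c | inj₁ b+c≤L rewrite m≥n⇒m⊓n≡n L≤a+c | m≤n⇒m⊓n≡m b+c≤L =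
  ≤-trans (short-long {k} {σ} {τ} {L} {b} {a} {c} 3σ≤L L+τ≤b+a+c k≤2σ k≤2b+c)
          (≤-reflexive (+-comm (b + c + b ⊓ σ) (L + a ⊓ σ)))
  where L+τ≤b+a+c = ≤-trans L+τ≤a+b+c (≤-reflexive (cong (_+ c) (+-comm a b)))
... | inj₂ L≤a+c | inj₂ L≤b+c rewrite m≥n⇒m⊓n≡n L≤a+c | m≥n⇒m⊓n≡n L≤b+c = begin
  k + (L + σ)                 ≡⟨ solve (k ∷ L ∷ σ ∷ []) ⟩
  k + σ + L                   ≤⟨ +-monoˡ-≤ L (k+σ≤L 3σ≤L k≤2σ) ⟩
  L + L                       ≤⟨ +-mono-≤ (m≤m+n L (a ⊓ σ)) (m≤m+n L (b ⊓ σ)) ⟩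
  (L + a ⊓ σ) + (L + b ⊓ σ)   ∎
  where open ≤-Reasoning

order-bounds : ∀ {s t m} → 2 ≤ s → 2 ≤ t → ((3 * s + t) ⊔ (s + 3 * t)) ∸ 4 ≤ m →
               s + t ≤ m × 3 * (s ∸ 1) + (t ∸ 1) ≤ m
order-bounds {suc (suc σ)} {suc (suc τ)} {m} (s≤s (s≤s z≤n)) (s≤s (s≤s z≤n)) bound = ≤-trans s+t≤ 3σ+τ≤m , 3σ+τ≤m
  where
  3σ+τ≤m : 3 * suc σ + suc τ ≤ m
  3σ+τ≤m = begin
    3 * suc σ + suc τ                                                  ≡⟨ m+n∸m≡n 4 (3 * suc σ + suc τ) ⟨
    4 + (3 * suc σ + suc τ) ∸ 4                                        ≡⟨ cong (_∸ 4) 4+3σ+τ≡3s+t ⟩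
    (3 * suc (suc σ) + suc (suc τ)) ∸ 4                                ≤⟨ ∸-monoˡ-≤ 4 (m≤m⊔n (3 * suc (suc σ) + suc (suc τ)) (suc (suc σ) + 3 * suc (suc τ))) ⟩
    ((3 * suc (suc σ) + suc (suc τ)) ⊔ (suc (suc σ) + 3 * suc (suc τ))) ∸ 4 ≤⟨ bound ⟩
    m                                                                  ∎
    where
    open ≤-Reasoning
    4+3σ+τ≡3s+t : 4 + (3 * suc σ + suc τ) ≡ 3 * suc (suc σ) + suc (suc τ)
    4+3σ+τ≡3s+t = solve (σ ∷ τ ∷ [])
  s+t≤ : suc (suc σ) + suc (suc τ) ≤ 3 * suc σ + suc τ
  s+t≤ = ≤-trans (m≤m+n _ (2 * σ)) (≤-reflexive (solve (σ ∷ τ ∷ [])))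

k≤2[s∸1] : ∀ {k s t} → 1 ≤ s → 1 ≤ t → k < 2 * (s ⊓ t) ∸ 1 → k ≤ 2 * (s ∸ 1) × k ≤ 2 * (t ∸ 1)
k≤2[s∸1] {k} {suc σ} {suc τ} _ _ k<2[s⊓t]∸1 =
  ≤-trans k≤2[σ⊓τ] (*-monoʳ-≤ 2 (m⊓n≤m σ τ)) , ≤-trans k≤2[σ⊓τ] (*-monoʳ-≤ 2 (m⊓n≤n σ τ))
  where
  k≤2[σ⊓τ] : k ≤ 2 * (σ ⊓ τ)
  k≤2[σ⊓τ] = ≤-pred (≤-trans k<2[s⊓t]∸1 (≤-reflexive (+-suc (σ ⊓ τ) (σ ⊓ τ + 0))))

-- Matroids

module MatroidFacts {n : ℕ} (M : Matroid n) where
  open Matroid M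

  private variable
    C W X Y : Subset n
    e : Fin n

  r-∪⁅⁆ : ∀ X e → r (X ∪ ⁅ e ⁆) ≤ suc (r X)
  r-∪⁅⁆ X e = begin
    r (X ∪ ⁅ e ⁆)                     ≤⟨ m≤m+n _ _ ⟩
    r (X ∪ ⁅ e ⁆) + r (X ∩ ⁅ e ⁆)     ≤⟨ r-sub X ⁅ e ⁆ ⟩
    r X + r ⁅ e ⁆                     ≤⟨ +-monoʳ-≤ (r X) (≤-trans (r-bound ⁅ e ⁆) (≤-reflexive (∣⁅x⁆∣≡1 e))) ⟩
    r X + 1                           ≡⟨ +-comm (r X) 1 ⟩
    suc (r X)                         ∎
    where open ≤-Reasoning

  circuit-closure : IsCircuit M C → e ∈ C → C ⊆ Y → r Y ≤ r (Y - e)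
  circuit-closure {C} {e} {Y} (dependent , minimal) e∈C C⊆Y =
    +-cancelʳ-≤ (r (C - e)) (r Y) (r (Y - e)) (begin
      r Y + r (C - e)                   ≤⟨ +-mono-≤ (r-mono Y⊆) (r-mono C-e⊆) ⟩
      r ((Y - e) ∪ C) + r ((Y - e) ∩ C) ≤⟨ r-sub (Y - e) C ⟩
      r (Y - e) + r C                   ≤⟨ +-monoʳ-≤ (r (Y - e)) rC≤ ⟩
      r (Y - e) + r (C - e)             ∎)
    where
    open ≤-Reasoning
    rC≤ : r C ≤ r (C - e)
    rC≤ = ≤-trans (≤-pred (≤-trans dependent (≤-reflexive (x∈p⇒∣p∣≡1+∣p-x∣ e∈C))))
                  (≤-reflexive (sym (minimal (C - e) (x∈p⇒p-x⊂p e∈C))))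
    Y⊆ : Y ⊆ (Y - e) ∪ C
    Y⊆ {x} x∈Y with x ≟ e
    ... | yes refl = x∈p∪q⁺ (inj₂ e∈C)
    ... | no x≢e   = x∈p∪q⁺ (inj₁ (x∈p∧x≢y⇒x∈p-y x∈Y x≢e))
    C-e⊆ : C - e ⊆ (Y - e) ∩ C
    C-e⊆ x∈ = x∈p∩q⁺ (x∈p∧x≢y⇒x∈p-y (C⊆Y (x∈p-y⇒x∈p x∈)) (x∈p-y⇒x≢y x∈) , x∈p-y⇒x∈p x∈)

  r*<∣X∣⇒r∁X<r⊤ : r* M X < ∣ X ∣ → r (∁ X) < r ⊤
  r*<∣X∣⇒r∁X<r⊤ {X} r*X<∣X∣ with r ⊤ ≤? r (∁ X)
  ... | no  r⊤≰ = ≰⇒> r⊤≰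
  ... | yes r⊤≤ = contradiction (≤-trans (m≤m+n ∣ X ∣ _) (≤-reflexive (sym (+-∸-assoc ∣ X ∣ r⊤≤)))) (<⇒≱ r*X<∣X∣)

  -- 0 < ∣ X ∣ excludes the truncated case r ⊤ ≥ ∣ X ∣ + r (∁ X), where r* X ≡ 0.
  r*≡∣X∣⇒r⊤≤r∁X : 0 < ∣ X ∣ → r* M X ≡ ∣ X ∣ → r ⊤ ≤ r (∁ X)
  r*≡∣X∣⇒r⊤≤r∁X {X} 0<∣X∣ r*X≡∣X∣ = ≤-reflexive (+-cancelˡ-≡ ∣ X ∣ (r ⊤) (r (∁ X)) (begin-equality
    ∣ X ∣ + r ⊤                      ≡⟨ cong (_+ r ⊤) r*X≡∣X∣ ⟨
    (∣ X ∣ + r (∁ X) ∸ r ⊤) + r ⊤    ≡⟨ m∸n+n≡m (<⇒≤ r⊤<) ⟩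
    ∣ X ∣ + r (∁ X)                  ∎))
    where
    open ≤-Reasoning
    r⊤< : r ⊤ < ∣ X ∣ + r (∁ X)
    r⊤< = m∸n≢0⇒n<m (λ r*X≡0 → >⇒≢ 0<∣X∣ (trans (sym r*X≡∣X∣) r*X≡0))

  cocircuit-complement : IsCocircuit M C → r (∁ C) < r ⊤
  cocircuit-complement (codependent , _) = r*<∣X∣⇒r∁X<r⊤ codependent

  cocircuit-hyperplane : IsCocircuit M C → 2 ≤ ∣ C ∣ → e ∈ C → r ⊤ ≤ r (∁ (C - e))
  cocircuit-hyperplane {C} {e} (_ , minimal) 2≤∣C∣ e∈C =
    r*≡∣X∣⇒r⊤≤r∁X (≤-pred (≤-trans 2≤∣C∣ (≤-reflexive (x∈p⇒∣p∣≡1+∣p-x∣ e∈C))))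
                  (minimal (C - e) (x∈p⇒p-x⊂p e∈C))

  cocircuit-coloop : IsCocircuit M C → 2 ≤ ∣ C ∣ → e ∈ C → e ∈ W →
                     (∀ {x} → x ∈ W → x ∈ C → x ≡ e) → suc (r (W - e)) ≤ r W
  cocircuit-coloop {C} {e} {W} cocircuit 2≤∣C∣ e∈C e∈W W∩C⊆e =
    +-cancelˡ-≤ (r (∁ C)) _ _ (begin
      r (∁ C) + suc (r (W - e))        ≡⟨ +-suc (r (∁ C)) (r (W - e)) ⟩
      suc (r (∁ C)) + r (W - e)        ≤⟨ +-monoˡ-≤ (r (W - e)) (cocircuit-complement cocircuit) ⟩
      r ⊤ + r (W - e)                  ≤⟨ +-mono-≤ (cocircuit-hyperplane cocircuit 2≤∣C∣ e∈C) (r-mono W-e⊆) ⟩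
      r (∁ (C - e)) + r (W ∩ ∁ C)      ≤⟨ +-monoˡ-≤ _ (r-mono ∁C-e⊆) ⟩
      r (W ∪ ∁ C) + r (W ∩ ∁ C)        ≤⟨ r-sub W (∁ C) ⟩
      r W + r (∁ C)                    ≡⟨ +-comm (r W) (r (∁ C)) ⟩
      r (∁ C) + r W                    ∎)
    where
    open ≤-Reasoning
    ∁C-e⊆ : ∁ (C - e) ⊆ W ∪ ∁ C
    ∁C-e⊆ {x} x∈ with x ≟ e
    ... | yes refl = x∈p∪q⁺ (inj₁ e∈W)
    ... | no x≢e   = x∈p∪q⁺ (inj₂ (x∉p⇒x∈∁p (λ x∈C → x∈∁p⇒x∉p x∈ (x∈p∧x≢y⇒x∈p-y x∈C x≢e))))
    W-e⊆ : W - e ⊆ W ∩ ∁ C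
    W-e⊆ x∈ = x∈p∩q⁺ (x∈p-y⇒x∈p x∈ , x∉p⇒x∈∁p λ x∈C → x∈p-y⇒x≢y x∈ (W∩C⊆e (x∈p-y⇒x∈p x∈) x∈C))

-- Spikes

module SpikeFacts {n m s t : ℕ} {M : Matroid n} {arm : Fin n → Fin m} (spike : IsSpike M s t m arm) where
  open Matroid M
  open IsSpike spike
  open MatroidFacts M
  open Preimage arm

  private
    U : Subset m → Subset n
    U = armsUnion arm

  ∣armsUnion∣ : ∀ S → ∣ U S ∣ ≡ ∣ S ∣ * 2
  ∣armsUnion∣ S = begin
    ∣ U S ∣      ≡⟨ cong ∣_∣ (∩-identityˡ (U S)) ⟨
    ∣ ⊤ ∩ U S ∣  ≡⟨ ∣P∩armsUnion∣ ⊤ S (λ {i} _ → trans (cong ∣_∣ (∩-identityˡ (U ⁅ i ⁆))) (armsSize i)) ⟩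
    ∣ S ∣ * 2    ∎
    where open ≡-Reasoning

  x∈arm⁺ : ∀ {x i} → arm x ≡ i → x ∈ U ⁅ i ⁆
  x∈arm⁺ {i = i} refl = x∈armsUnion⁺ (x∈⁅x⁆ i)

  x∈arm⁻ : ∀ {x i} → x ∈ U ⁅ i ⁆ → arm x ≡ i
  x∈arm⁻ {i = i} x∈ = x∈⁅y⁆⇒x≡y i (x∈armsUnion⁻ ⁅ i ⁆ x∈)

  private
    module Arm (i : Fin m) = Doubleton (∣p∣≡2⇒Doubleton {p = U ⁅ i ⁆} (armsSize i))

  arm₁ arm₂ : Fin m → Fin n
  arm₁ = Arm.fst
  arm₂ = Arm.snd

  arm-arm₁ : ∀ i → arm (arm₁ i) ≡ i
  arm-arm₁ i = x∈arm⁻ (Arm.fst∈ i)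

  arm-arm₂ : ∀ i → arm (arm₂ i) ≡ i
  arm-arm₂ i = x∈arm⁻ (Arm.snd∈ i)

  arm₁≢arm₂ : ∀ i → arm₁ i ≢ arm₂ i
  arm₁≢arm₂ = Arm.fst≢snd

  arm-elements : ∀ {x i} → arm x ≡ i → x ≡ arm₁ i ⊎ x ≡ arm₂ i
  arm-elements {i = i} ax≡i = Arm.elements i (x∈arm⁺ ax≡i)

  s≤m : s ≤ m
  s≤m = ≤-trans (m≤m⊔n s t) order

  t≤m : t ≤ m
  t≤m = ≤-trans (m≤n⊔m s t) order

  private
    arms-of-size : ∀ {k} → k ≤ m → ∃[ S ] ∣ S ∣ ≡ k
    arms-of-size k≤m =
      let S , _ , ∣S∣≡k = subset-of-size (⊤ {m}) (≤-trans k≤m (≤-reflexive (sym (∣⊤∣≡n m)))) in S , ∣S∣≡k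

    0<k*2⇒0<k : ∀ k → 0 < k * 2 → 0 < k
    0<k*2⇒0<k (suc k) _ = s≤s z≤n

  -- The empty set is neither a circuit nor a cocircuit, so s and t are positive.
  1≤s : 1 ≤ s
  1≤s = let S , ∣S∣≡s = arms-of-size s≤m in
    0<k*2⇒0<k s (subst (0 <_) (trans (∣armsUnion∣ S) (cong (_* 2) ∣S∣≡s)) (≤-<-trans z≤n (proj₁ (circuits S ∣S∣≡s))))

  1≤t : 1 ≤ t
  1≤t = let T , ∣T∣≡t = arms-of-size t≤m in
    0<k*2⇒0<k t (subst (0 <_) (trans (∣armsUnion∣ T) (cong (_* 2) ∣T∣≡t)) (≤-<-trans z≤n (proj₁ (cocircuits T ∣T∣≡t))))

  2≤∣cocircuit∣ : ∀ T → ∣ T ∣ ≡ t → 2 ≤ ∣ U T ∣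
  2≤∣cocircuit∣ T ∣T∣≡t = ≤-trans (*-monoˡ-≤ 2 (≤-trans 1≤t (≤-reflexive (sym ∣T∣≡t)))) (≤-reflexive (sym (∣armsUnion∣ T)))

  -- One element of arm i lies on a circuit formed with s - 1 other arms of S.
  r-armsUnion-step : ∀ S {i} → i ∈ S → s ∸ 1 ≤ ∣ S - i ∣ → r (U S) ≤ suc (r (U (S - i)))
  r-armsUnion-step S {i} i∈S s∸1≤ with subset-of-size (S - i) s∸1≤
  ... | B , B⊆S-i , ∣B∣≡s∸1 = begin
    r (U S)                    ≤⟨ circuit-closure (circuits T ∣T∣≡s) (x∈armsUnion⁺ i-side) UT⊆US ⟩
    r (U S - arm₁ i)           ≤⟨ r-mono US-u⊆ ⟩
    r (U (S - i) ∪ ⁅ arm₂ i ⁆) ≤⟨ r-∪⁅⁆ _ (arm₂ i) ⟩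
    suc (r (U (S - i)))        ∎
    where
    open ≤-Reasoning
    T : Subset m
    T = B ∪ ⁅ i ⁆
    ∣T∣≡s : ∣ T ∣ ≡ s
    ∣T∣≡s = begin-equality
      ∣ B ∪ ⁅ i ⁆ ∣     ≡⟨ ∣p∪q∣≡∣p∣+∣q∣ B ⁅ i ⁆ (λ j∈B j∈⁅i⁆ → x∈p-y⇒x≢y (B⊆S-i j∈B) (x∈⁅y⁆⇒x≡y i j∈⁅i⁆)) ⟩
      ∣ B ∣ + ∣ ⁅ i ⁆ ∣ ≡⟨ cong₂ _+_ ∣B∣≡s∸1 (∣⁅x⁆∣≡1 i) ⟩
      s ∸ 1 + 1         ≡⟨ m∸n+n≡m 1≤s ⟩
      s                 ∎
    i-side : arm (arm₁ i) ∈ T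
    i-side = x∈p∪q⁺ (inj₂ (x≡y⇒x∈⁅y⁆ (arm-arm₁ i)))
    UT⊆US : U T ⊆ U S
    UT⊆US x∈ with x∈p∪q⁻ B ⁅ i ⁆ (x∈armsUnion⁻ T x∈)
    ... | inj₁ ax∈B   = x∈armsUnion⁺ (x∈p-y⇒x∈p (B⊆S-i ax∈B))
    ... | inj₂ ax∈⁅i⁆ = x∈armsUnion⁺ (subst (_∈ S) (sym (x∈⁅y⁆⇒x≡y i ax∈⁅i⁆)) i∈S)
    US-u⊆ : U S - arm₁ i ⊆ U (S - i) ∪ ⁅ arm₂ i ⁆
    US-u⊆ {x} x∈ with arm x ≟ i
    ... | no ax≢i = x∈p∪q⁺ (inj₁ (x∈armsUnion⁺ (x∈p∧x≢y⇒x∈p-y (x∈armsUnion⁻ S (x∈p-y⇒x∈p x∈)) ax≢i)))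
    ... | yes ax≡i with arm-elements ax≡i
    ...   | inj₁ x≡u = contradiction x≡u (x∈p-y⇒x≢y x∈)
    ...   | inj₂ x≡v = x∈p∪q⁺ (inj₂ (x≡y⇒x∈⁅y⁆ x≡v))

  r-armsUnion-upper : ∀ S → s ≤ ∣ S ∣ → r (U S) < ∣ S ∣ + s
  r-armsUnion-upper S s≤∣S∣ = go ∣ S ∣ S refl s≤∣S∣
    where
    go : ∀ k S → ∣ S ∣ ≡ k → s ≤ k → r (U S) < k + s
    go zero S _ s≤0 = contradiction (≤-trans 1≤s s≤0) λ ()
    go (suc k) S ∣S∣≡1+k s≤1+k with m≤n⇒m<n∨m≡n s≤1+k | ∣p∣≡1+k⇒Nonempty ∣S∣≡1+k
    ... | inj₂ s≡1+k | _ = begin-strict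
      r (U S)             <⟨ proj₁ (circuits S (trans ∣S∣≡1+k (sym s≡1+k))) ⟩
      ∣ U S ∣             ≡⟨ ∣armsUnion∣ S ⟩
      ∣ S ∣ * 2           ≡⟨ cong (_* 2) ∣S∣≡1+k ⟩
      suc k * 2           ≡⟨ *-comm (suc k) 2 ⟩
      suc k + (suc k + 0) ≡⟨ cong (suc k +_) (trans (+-identityʳ (suc k)) (sym s≡1+k)) ⟩
      suc k + s           ∎
      where open ≤-Reasoning
    ... | inj₁ (s≤s s≤k) | i , i∈S = begin-strict
      r (U S)             ≤⟨ r-armsUnion-step S i∈S (≤-trans (m∸n≤m s 1) (subst (s ≤_) (sym ∣S-i∣≡k) s≤k)) ⟩
      suc (r (U (S - i))) <⟨ s≤s (go k (S - i) ∣S-i∣≡k s≤k) ⟩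
      suc k + s           ∎
      where
      open ≤-Reasoning
      ∣S-i∣≡k : ∣ S - i ∣ ≡ k
      ∣S-i∣≡k = x∈p∧∣p∣≡1+k⇒∣p-x∣≡k i∈S ∣S∣≡1+k

  r-⊤-upper : s + t ≤ m → r ⊤ + t ≤ m + s
  r-⊤-upper s+t≤m with arms-of-size t≤m
  ... | T , ∣T∣≡t with 0<∣p∣⇒Nonempty {p = U T} (≤-trans (s≤s z≤n) (2≤∣cocircuit∣ T ∣T∣≡t))
  ...   | e , e∈UT = begin
    r ⊤ + t                   ≤⟨ +-monoˡ-≤ t r⊤≤ ⟩
    ∣ ∁ T ∣ + s + t           ≡⟨ xy∙z≈xz∙y ∣ ∁ T ∣ s t ⟩
    ∣ ∁ T ∣ + t + s           ≡⟨ cong (_+ s) (trans (+-comm ∣ ∁ T ∣ t) ∣T∣+∣∁T∣≡m) ⟩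
    m + s                     ∎
    where
    open ≤-Reasoning
    ∣T∣+∣∁T∣≡m : t + ∣ ∁ T ∣ ≡ m
    ∣T∣+∣∁T∣≡m = trans (cong (_+ ∣ ∁ T ∣) (sym ∣T∣≡t)) (∣p∣+∣∁p∣≡n T)
    s≤∣∁T∣ : s ≤ ∣ ∁ T ∣
    s≤∣∁T∣ = +-cancelˡ-≤ t s _ (≤-trans (≤-reflexive (+-comm t s)) (≤-trans s+t≤m (≤-reflexive (sym ∣T∣+∣∁T∣≡m))))
    ∁UT-e⊆ : ∁ (U T - e) ⊆ U (∁ T) ∪ ⁅ e ⁆
    ∁UT-e⊆ {x} x∈ with x ≟ e
    ... | yes x≡e = x∈p∪q⁺ (inj₂ (x≡y⇒x∈⁅y⁆ x≡e))
    ... | no x≢e  = x∈p∪q⁺ (inj₁ (x∈armsUnion⁺ (x∉p⇒x∈∁p {p = T} λ ax∈T →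
                      x∈∁p⇒x∉p x∈ (x∈p∧x≢y⇒x∈p-y (x∈armsUnion⁺ ax∈T) x≢e))))
    r⊤≤ : r ⊤ ≤ ∣ ∁ T ∣ + s
    r⊤≤ = begin
      r ⊤                   ≤⟨ cocircuit-hyperplane (cocircuits T ∣T∣≡t) (2≤∣cocircuit∣ T ∣T∣≡t) e∈UT ⟩
      r (∁ (U T - e))       ≤⟨ r-mono ∁UT-e⊆ ⟩
      r (U (∁ T) ∪ ⁅ e ⁆)   ≤⟨ r-∪⁅⁆ (U (∁ T)) e ⟩
      suc (r (U (∁ T)))     ≤⟨ r-armsUnion-upper (∁ T) s≤∣∁T∣ ⟩
      ∣ ∁ T ∣ + s           ∎

  -- Fewer than s arms lie properly inside an s-arm circuit.
  r-armsUnion-independent : ∀ F → ∣ F ∣ < s → r (U F) ≡ ∣ F ∣ * 2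
  r-armsUnion-independent F ∣F∣<s
    with disjoint-subset-of-size F (≤-trans (≤-reflexive (m+[n∸m]≡n (<⇒≤ ∣F∣<s))) s≤m)
  ... | E , F#E , ∣E∣≡s∸∣F∣ with 0<∣p∣⇒Nonempty {p = E} (subst (0 <_) (sym ∣E∣≡s∸∣F∣) (m<n⇒0<n∸m ∣F∣<s))
  ...   | j , j∈E = trans (proj₂ (circuits (F ∪ E) ∣F∪E∣≡s) (U F) (UF⊆UF∪E , arm₁ j , j₁∈ , j₁∉)) (∣armsUnion∣ F)
    where
    ∣F∪E∣≡s : ∣ F ∪ E ∣ ≡ s
    ∣F∪E∣≡s = trans (∣p∪q∣≡∣p∣+∣q∣ F E F#E) (trans (cong (∣ F ∣ +_) ∣E∣≡s∸∣F∣) (m+[n∸m]≡n (<⇒≤ ∣F∣<s)))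
    UF⊆UF∪E : U F ⊆ U (F ∪ E)
    UF⊆UF∪E x∈ = x∈armsUnion⁺ (x∈p∪q⁺ {q = E} (inj₁ (x∈armsUnion⁻ F x∈)))
    j₁∈ : arm₁ j ∈ U (F ∪ E)
    j₁∈ = x∈armsUnion⁺ (x∈p∪q⁺ {p = F} (inj₂ (subst (_∈ E) (sym (arm-arm₁ j)) j∈E)))
    j₁∉ : arm₁ j ∉ U F
    j₁∉ j₁∈UF = F#E (subst (_∈ F) (arm-arm₁ j) (x∈armsUnion⁻ F j₁∈UF)) j∈E

  -- An element alone on its arm within W is a coloop of W when W touches few arms, since then a
  -- t-arm cocircuit through that arm can avoid all other arms W touches.
  lone-element-coloop : ∀ A W {x} → ∣ A ∣ + (t ∸ 1) ≤ m → (∀ {y} → y ∈ W → arm y ∈ A) →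
                        x ∈ W → (∀ {y} → y ∈ W → arm y ≡ arm x → y ≡ x) → suc (r (W - x)) ≤ r W
  lone-element-coloop A W {x} ∣A∣+t∸1≤m W⊆A x∈W lone with disjoint-subset-of-size A ∣A∣+t∸1≤m
  ... | E , A#E , ∣E∣≡t∸1 = cocircuit-coloop (cocircuits T ∣T∣≡t) (2≤∣cocircuit∣ T ∣T∣≡t) x∈UT x∈W W∩UT⊆x
    where
    T : Subset m
    T = ⁅ arm x ⁆ ∪ E
    ∣T∣≡t : ∣ T ∣ ≡ t
    ∣T∣≡t = begin-equality
      ∣ ⁅ arm x ⁆ ∪ E ∣     ≡⟨ ∣p∪q∣≡∣p∣+∣q∣ ⁅ arm x ⁆ E (λ i∈⁅ax⁆ → A#E (subst (_∈ A) (sym (x∈⁅y⁆⇒x≡y _ i∈⁅ax⁆)) (W⊆A x∈W))) ⟩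
      ∣ ⁅ arm x ⁆ ∣ + ∣ E ∣ ≡⟨ cong₂ _+_ (∣⁅x⁆∣≡1 (arm x)) ∣E∣≡t∸1 ⟩
      1 + (t ∸ 1)         ≡⟨ m+[n∸m]≡n 1≤t ⟩
      t                   ∎
      where open ≤-Reasoning
    x∈UT : x ∈ U T
    x∈UT = x∈armsUnion⁺ (x∈p∪q⁺ (inj₁ (x∈⁅x⁆ (arm x))))
    W∩UT⊆x : ∀ {y} → y ∈ W → y ∈ U T → y ≡ x
    W∩UT⊆x y∈W y∈UT with x∈p∪q⁻ ⁅ arm x ⁆ E (x∈armsUnion⁻ T y∈UT)
    ... | inj₁ ay∈⁅ax⁆ = lone y∈W (x∈⁅y⁆⇒x≡y _ ay∈⁅ax⁆)
    ... | inj₂ ay∈E    = contradiction ay∈E (A#E (W⊆A y∈W))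

  record FullHalf (F H : Subset m) (W : Subset n) : Set where
    field
      disjoint : Disjoint F H
      full⊆    : U F ⊆ W
      ⊆arms    : ∀ {x} → x ∈ W → arm x ∈ F ∪ H
      half     : ∀ {i} → i ∈ H → ∃[ x ] x ∈ W × arm x ≡ i
      unique   : ∀ {x y} → x ∈ W → y ∈ W → arm x ≡ arm y → arm x ∈ H → x ≡ y

  remove-half : ∀ {F H W x} → FullHalf F H W → x ∈ W → arm x ∈ H → FullHalf F (H - arm x) (W - x)
  remove-half {F} {H} {W} {x} fh x∈W ax∈H = record
    { disjoint = λ i∈F i∈H-ax → disjoint i∈F (x∈p-y⇒x∈p i∈H-ax)
    ; full⊆    = λ {y} y∈UF → x∈p∧x≢y⇒x∈p-y (full⊆ y∈UF)
                   λ { refl → disjoint (x∈armsUnion⁻ F y∈UF) ax∈H }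
    ; ⊆arms    = ⊆arms′
    ; half     = half′
    ; unique   = λ y∈ z∈ ay≡az ay∈ → unique (x∈p-y⇒x∈p y∈) (x∈p-y⇒x∈p z∈) ay≡az (x∈p-y⇒x∈p ay∈)
    }
    where
    open FullHalf fh
    ⊆arms′ : ∀ {y} → y ∈ W - x → arm y ∈ F ∪ (H - arm x)
    ⊆arms′ {y} y∈ with x∈p∪q⁻ F H (⊆arms (x∈p-y⇒x∈p y∈)) | arm y ≟ arm x
    ... | inj₁ ay∈F | _        = x∈p∪q⁺ (inj₁ ay∈F)
    ... | inj₂ ay∈H | yes ay≡ax = contradiction (unique (x∈p-y⇒x∈p y∈) x∈W ay≡ax ay∈H) (x∈p-y⇒x≢y y∈)
    ... | inj₂ ay∈H | no ay≢ax  = x∈p∪q⁺ (inj₂ (x∈p∧x≢y⇒x∈p-y ay∈H ay≢ax))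
    half′ : ∀ {i} → i ∈ H - arm x → ∃[ z ] z ∈ W - x × arm z ≡ i
    half′ i∈ with half (x∈p-y⇒x∈p i∈)
    ... | z , z∈W , az≡i = z , x∈p∧x≢y⇒x∈p-y z∈W (λ { refl → x∈p-y⇒x≢y i∈ (sym az≡i) }) , az≡i

  split-full : ∀ {F H W i} → FullHalf F H W → ∣ H ∣ ≡ 0 → i ∈ F → FullHalf (F - i) ⁅ i ⁆ (W - arm₁ i)
  split-full {F} {H} {W} {i} fh ∣H∣≡0 i∈F = record
    { disjoint = λ j∈F-i j∈⁅i⁆ → x∈p-y⇒x≢y j∈F-i (x∈⁅y⁆⇒x≡y i j∈⁅i⁆)
    ; full⊆    = λ {y} y∈ → let ay∈F-i = x∈armsUnion⁻ (F - i) y∈ in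
                   x∈p∧x≢y⇒x∈p-y (full⊆ (x∈armsUnion⁺ (x∈p-y⇒x∈p ay∈F-i)))
                     λ { refl → x∈p-y⇒x≢y ay∈F-i (arm-arm₁ i) }
    ; ⊆arms    = ⊆arms′
    ; half     = λ j∈⁅i⁆ → arm₂ i , arm₂∈ , trans (arm-arm₂ i) (sym (x∈⁅y⁆⇒x≡y i j∈⁅i⁆))
    ; unique   = λ y∈ z∈ ay≡az ay∈⁅i⁆ → trans (is-arm₂ y∈ (x∈⁅y⁆⇒x≡y i ay∈⁅i⁆))
                                              (sym (is-arm₂ z∈ (trans (sym ay≡az) (x∈⁅y⁆⇒x≡y i ay∈⁅i⁆))))
    }
    where
    open FullHalf fh
    ⊆arms′ : ∀ {y} → y ∈ W - arm₁ i → arm y ∈ (F - i) ∪ ⁅ i ⁆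
    ⊆arms′ {y} y∈ with x∈p∪q⁻ F H (⊆arms (x∈p-y⇒x∈p y∈)) | arm y ≟ i
    ... | inj₂ ay∈H | _        = contradiction ∣H∣≡0 (>⇒≢ (x∈p⇒0<∣p∣ ay∈H))
    ... | inj₁ ay∈F | yes ay≡i = x∈p∪q⁺ (inj₂ (x≡y⇒x∈⁅y⁆ ay≡i))
    ... | inj₁ ay∈F | no ay≢i  = x∈p∪q⁺ (inj₁ (x∈p∧x≢y⇒x∈p-y ay∈F ay≢i))
    arm₂∈ : arm₂ i ∈ W - arm₁ i
    arm₂∈ = x∈p∧x≢y⇒x∈p-y (full⊆ (x∈armsUnion⁺ (subst (_∈ F) (sym (arm-arm₂ i)) i∈F))) (arm₁≢arm₂ i ∘ sym)
    is-arm₂ : ∀ {y} → y ∈ W - arm₁ i → arm y ≡ i → y ≡ arm₂ i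
    is-arm₂ y∈ ay≡i with arm-elements ay≡i
    ... | inj₁ y≡arm₁ = contradiction y≡arm₁ (x∈p-y⇒x≢y y∈)
    ... | inj₂ y≡arm₂ = y≡arm₂

  -- Each half arm adds one to the rank (it is a coloop); full arms add two each, up to the
  -- first s - 1 of them, and one each thereafter (splitting one into a half arm).
  r-FullHalf-lower : ∀ f h {F H W} → ∣ F ∣ ≡ f → ∣ H ∣ ≡ h → f + h + (t ∸ 1) ≤ m → FullHalf F H W →
                     f + h + f ⊓ (s ∸ 1) ≤ r W
  r-FullHalf-lower f (suc h) {F} {H} {W} ∣F∣≡f ∣H∣≡1+h bound fh
    with ∣p∣≡1+k⇒Nonempty ∣H∣≡1+h
  ... | i , i∈H with FullHalf.half fh i∈H
  ...   | x , x∈W , refl = begin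
    f + suc h + f ⊓ (s ∸ 1)   ≡⟨ cong (_+ f ⊓ (s ∸ 1)) (+-suc f h) ⟩
    suc (f + h + f ⊓ (s ∸ 1)) ≤⟨ s≤s (r-FullHalf-lower f h ∣F∣≡f ∣H-i∣≡h bound′ (remove-half fh x∈W i∈H)) ⟩
    suc (r (W - x))           ≤⟨ lone-element-coloop (F ∪ H) W ∣F∪H∣+t∸1≤m (FullHalf.⊆arms fh) x∈W lone ⟩
    r W                       ∎
    where
    open ≤-Reasoning
    ∣H-i∣≡h : ∣ H - arm x ∣ ≡ h
    ∣H-i∣≡h = x∈p∧∣p∣≡1+k⇒∣p-x∣≡k i∈H ∣H∣≡1+h
    bound′ : f + h + (t ∸ 1) ≤ m
    bound′ = ≤-trans (+-monoˡ-≤ (t ∸ 1) (+-monoʳ-≤ f (n≤1+n h))) bound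
    ∣F∪H∣+t∸1≤m : ∣ F ∪ H ∣ + (t ∸ 1) ≤ m
    ∣F∪H∣+t∸1≤m =
      ≤-trans (+-monoˡ-≤ (t ∸ 1) (≤-trans (∣p∪q∣≤∣p∣+∣q∣ F H) (≤-reflexive (cong₂ _+_ ∣F∣≡f ∣H∣≡1+h)))) bound
    lone : ∀ {y} → y ∈ W → arm y ≡ arm x → y ≡ x
    lone y∈W ay≡ax = FullHalf.unique fh y∈W x∈W ay≡ax (subst (_∈ H) (sym ay≡ax) i∈H)
  r-FullHalf-lower f zero _ _ _ _ with f ≤? s ∸ 1
  r-FullHalf-lower f zero {F} {H} {W} ∣F∣≡f _ _ fh | yes f≤s∸1 = begin
    f + 0 + f ⊓ (s ∸ 1) ≡⟨ cong₂ _+_ (+-identityʳ f) (m≤n⇒m⊓n≡m f≤s∸1) ⟩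
    f + f               ≡⟨ cong (f +_) (+-identityʳ f) ⟨
    2 * f               ≡⟨ *-comm 2 f ⟩
    f * 2               ≡⟨ cong (_* 2) ∣F∣≡f ⟨
    ∣ F ∣ * 2           ≡⟨ r-armsUnion-independent F ∣F∣<s ⟨
    r (U F)             ≤⟨ r-mono (FullHalf.full⊆ fh) ⟩
    r W                 ∎
    where
    open ≤-Reasoning
    ∣F∣<s : ∣ F ∣ < s
    ∣F∣<s = ≤-trans (s≤s (≤-trans (≤-reflexive ∣F∣≡f) f≤s∸1)) (≤-reflexive (m+[n∸m]≡n 1≤s))
  r-FullHalf-lower zero zero _ _ _ _ | no 0≰s∸1 = contradiction z≤n 0≰s∸1
  r-FullHalf-lower (suc f) zero {F} {H} {W} ∣F∣≡1+f ∣H∣≡0 bound fh | no 1+f≰s∸1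
    with ∣p∣≡1+k⇒Nonempty ∣F∣≡1+f
  ... | i , i∈F = begin
    suc f + 0 + suc f ⊓ (s ∸ 1) ≡⟨ cong₂ _+_ (trans (+-identityʳ (suc f)) (+-comm 1 f))
                                              (m≥n⇒m⊓n≡n (≤-trans s∸1≤f (n≤1+n f))) ⟩
    f + 1 + (s ∸ 1)             ≡⟨ cong (f + 1 +_) (m≥n⇒m⊓n≡n s∸1≤f) ⟨
    f + 1 + f ⊓ (s ∸ 1)         ≤⟨ r-FullHalf-lower f 1 ∣F-i∣≡f (∣⁅x⁆∣≡1 i) bound′ (split-full fh ∣H∣≡0 i∈F) ⟩
    r (W - arm₁ i)              ≤⟨ r-mono (x∈p-y⇒x∈p {p = W}) ⟩
    r W                         ∎
    where
    open ≤-Reasoning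
    s∸1≤f : s ∸ 1 ≤ f
    s∸1≤f = ≤-pred (≰⇒> 1+f≰s∸1)
    ∣F-i∣≡f : ∣ F - i ∣ ≡ f
    ∣F-i∣≡f = x∈p∧∣p∣≡1+k⇒∣p-x∣≡k i∈F ∣F∣≡1+f
    bound′ : f + 1 + (t ∸ 1) ≤ m
    bound′ = ≤-trans (≤-reflexive (cong (_+ (t ∸ 1)) (trans (+-comm f 1) (sym (+-identityʳ (suc f)))))) bound

  fullArms halfArms : Subset n → Subset m
  fullArms Z = tabulate λ i → lookup Z (arm₁ i) ∧ lookup Z (arm₂ i)
  halfArms Z = tabulate λ i → lookup Z (arm₁ i) xor lookup Z (arm₂ i)

  armsUnion-fullArms⊆ : ∀ Z → U (fullArms Z) ⊆ Z
  armsUnion-fullArms⊆ Z {x} x∈ with x∈tabulate⁻ (x∈armsUnion⁻ (fullArms Z) x∈) | arm-elements {x} refl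
  ... | both | inj₁ x≡arm₁ = subst (_∈ Z) (sym x≡arm₁) (lookup⇒[]= _ Z (∧-conicalˡ _ _ both))
  ... | both | inj₂ x≡arm₂ = subst (_∈ Z) (sym x≡arm₂) (lookup⇒[]= _ Z (∧-conicalʳ _ _ both))

  both∉halfArms : ∀ Z {i} → arm₁ i ∈ Z → arm₂ i ∈ Z → i ∉ halfArms Z
  both∉halfArms Z arm₁∈ arm₂∈ i∈ =
    contradiction (trans (sym (x∈tabulate⁻ i∈)) (cong₂ _xor_ ([]=⇒lookup arm₁∈) ([]=⇒lookup arm₂∈))) λ ()

  fullArms∉halfArms : ∀ Z {i} → i ∈ fullArms Z → i ∉ halfArms Z
  fullArms∉halfArms Z {i} i∈ = both∉halfArms Z (on-arm (arm-arm₁ i)) (on-arm (arm-arm₂ i))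
    where
    on-arm : ∀ {x} → arm x ≡ i → x ∈ Z
    on-arm ax≡i = armsUnion-fullArms⊆ Z (x∈armsUnion⁺ (subst (_∈ fullArms Z) (sym ax≡i) i∈))

  halfArms-element : ∀ Z {i} → i ∈ halfArms Z → ∃[ x ] x ∈ Z × arm x ≡ i
  halfArms-element Z {i} i∈ with lookup Z (arm₁ i) in e₁ | lookup Z (arm₂ i) in e₂ | x∈tabulate⁻ i∈
  ... | true  | _     | _ = arm₁ i , lookup⇒[]= _ Z e₁ , arm-arm₁ i
  ... | false | true  | _ = arm₂ i , lookup⇒[]= _ Z e₂ , arm-arm₂ i

  halfArms-unique : ∀ Z {x y} → x ∈ Z → y ∈ Z → arm x ≡ arm y → arm x ∈ halfArms Z → x ≡ y
  halfArms-unique Z {x} {y} x∈Z y∈Z ax≡ay i∈ with arm-elements {x} refl | arm-elements (sym ax≡ay)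
  ... | inj₁ x≡arm₁ | inj₁ y≡arm₁ = trans x≡arm₁ (sym y≡arm₁)
  ... | inj₂ x≡arm₂ | inj₂ y≡arm₂ = trans x≡arm₂ (sym y≡arm₂)
  ... | inj₁ x≡arm₁ | inj₂ y≡arm₂ =
    contradiction i∈ (both∉halfArms Z (subst (_∈ Z) x≡arm₁ x∈Z) (subst (_∈ Z) y≡arm₂ y∈Z))
  ... | inj₂ x≡arm₂ | inj₁ y≡arm₁ =
    contradiction i∈ (both∉halfArms Z (subst (_∈ Z) y≡arm₁ y∈Z) (subst (_∈ Z) x≡arm₂ x∈Z))

  arm-classes : ∀ Z i → i ∈ fullArms Z ⊎ i ∈ halfArms Z ⊎ i ∈ fullArms (∁ Z)
  arm-classes Z i with lookup Z (arm₁ i) in e₁ | lookup Z (arm₂ i) in e₂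
  ... | true  | true  = inj₁ (x∈tabulate⁺ (cong₂ _∧_ e₁ e₂))
  ... | true  | false = inj₂ (inj₁ (x∈tabulate⁺ (cong₂ _xor_ e₁ e₂)))
  ... | false | true  = inj₂ (inj₁ (x∈tabulate⁺ (cong₂ _xor_ e₁ e₂)))
  ... | false | false = inj₂ (inj₂ (x∈tabulate⁺ (cong₂ _∧_ (lookup-∁ e₁) (lookup-∁ e₂))))
    where
    lookup-∁ : ∀ {x} → lookup Z x ≡ false → lookup (∁ Z) x ≡ true
    lookup-∁ {x} e = trans (lookup-map x not Z) (cong not e)

  halfArms-∁ : ∀ Z → halfArms (∁ Z) ≡ halfArms Z
  halfArms-∁ Z = tabulate-cong λ i →
    trans (cong₂ _xor_ (lookup-map (arm₁ i) not Z) (lookup-map (arm₂ i) not Z))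
          (xor-annihilates-not (lookup Z (arm₁ i)) (lookup Z (arm₂ i)))

  ∣Z∣≤∣fullArms∣*2+∣halfArms∣ : ∀ Z → ∣ Z ∣ ≤ ∣ fullArms Z ∣ * 2 + ∣ halfArms Z ∣
  ∣Z∣≤∣fullArms∣*2+∣halfArms∣ Z = begin
    ∣ Z ∣                                             ≤⟨ p⊆q⇒∣p∣≤∣q∣ Z⊆ ⟩
    ∣ U (fullArms Z) ∪ (Z ∩ U (halfArms Z)) ∣         ≤⟨ ∣p∪q∣≤∣p∣+∣q∣ (U (fullArms Z)) (Z ∩ U (halfArms Z)) ⟩
    ∣ U (fullArms Z) ∣ + ∣ Z ∩ U (halfArms Z) ∣       ≡⟨ cong₂ _+_ (∣armsUnion∣ (fullArms Z)) (∣P∩armsUnion∣ Z (halfArms Z) one) ⟩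
    ∣ fullArms Z ∣ * 2 + ∣ halfArms Z ∣ * 1           ≡⟨ cong (∣ fullArms Z ∣ * 2 +_) (*-identityʳ (∣ halfArms Z ∣)) ⟩
    ∣ fullArms Z ∣ * 2 + ∣ halfArms Z ∣               ∎
    where
    open ≤-Reasoning
    Z⊆ : Z ⊆ U (fullArms Z) ∪ (Z ∩ U (halfArms Z))
    Z⊆ {x} x∈Z with arm-classes Z (arm x)
    ... | inj₁ ax∈full        = x∈p∪q⁺ (inj₁ (x∈armsUnion⁺ ax∈full))
    ... | inj₂ (inj₁ ax∈half) = x∈p∪q⁺ (inj₂ (x∈p∩q⁺ (x∈Z , x∈armsUnion⁺ ax∈half)))
    ... | inj₂ (inj₂ ax∈full∁) =
      contradiction x∈Z (x∈∁p⇒x∉p (armsUnion-fullArms⊆ (∁ Z) (x∈armsUnion⁺ ax∈full∁)))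
    one : ∀ {i} → i ∈ halfArms Z → ∣ Z ∩ U ⁅ i ⁆ ∣ ≡ 1
    one {i} i∈ with halfArms-element Z i∈
    ... | x , x∈Z , ax≡i = trans (cong ∣_∣ (⊆-antisym ⊆⁅x⁆ ⁅x⁆⊆)) (∣⁅x⁆∣≡1 x)
      where
      ⊆⁅x⁆ : Z ∩ U ⁅ i ⁆ ⊆ ⁅ x ⁆
      ⊆⁅x⁆ y∈ = let y∈Z , y∈arm = x∈p∩q⁻ Z _ y∈ in
        x≡y⇒x∈⁅y⁆ (halfArms-unique Z y∈Z x∈Z (trans (x∈arm⁻ y∈arm) (sym ax≡i))
                                   (subst (_∈ halfArms Z) (sym (x∈arm⁻ y∈arm)) i∈))
      ⁅x⁆⊆ : ⁅ x ⁆ ⊆ Z ∩ U ⁅ i ⁆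
      ⁅x⁆⊆ y∈ = subst (_∈ Z ∩ U ⁅ i ⁆) (sym (x∈⁅y⁆⇒x≡y x y∈)) (x∈p∩q⁺ (x∈Z , x∈arm⁺ ax≡i))

  m≤∣fullArms∣+∣halfArms∣+∣fullArms∁∣ : ∀ Z → m ≤ ∣ fullArms Z ∣ + ∣ halfArms Z ∣ + ∣ fullArms (∁ Z) ∣
  m≤∣fullArms∣+∣halfArms∣+∣fullArms∁∣ Z = begin
    m                                                   ≡⟨ ∣⊤∣≡n m ⟨
    ∣ ⊤ {m} ∣                                               ≤⟨ p⊆q⇒∣p∣≤∣q∣ ⊤⊆ ⟩
    ∣ fullArms Z ∪ halfArms Z ∪ fullArms (∁ Z) ∣        ≤⟨ ∣p∪q∣≤∣p∣+∣q∣ (fullArms Z) _ ⟩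
    ∣ fullArms Z ∣ + ∣ halfArms Z ∪ fullArms (∁ Z) ∣    ≤⟨ +-monoʳ-≤ (∣ fullArms Z ∣) (∣p∪q∣≤∣p∣+∣q∣ (halfArms Z) (fullArms (∁ Z))) ⟩
    ∣ fullArms Z ∣ + (∣ halfArms Z ∣ + ∣ fullArms (∁ Z) ∣) ≡⟨ +-assoc (∣ fullArms Z ∣) (∣ halfArms Z ∣) (∣ fullArms (∁ Z) ∣) ⟨
    ∣ fullArms Z ∣ + ∣ halfArms Z ∣ + ∣ fullArms (∁ Z) ∣  ∎
    where
    open ≤-Reasoning
    ⊤⊆ : ⊤ ⊆ fullArms Z ∪ halfArms Z ∪ fullArms (∁ Z)
    ⊤⊆ {i} _ with arm-classes Z i
    ... | inj₁ i∈               = x∈p∪q⁺ (inj₁ i∈)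
    ... | inj₂ (inj₁ i∈)        = x∈p∪q⁺ (inj₂ (x∈p∪q⁺ (inj₁ i∈)))
    ... | inj₂ (inj₂ i∈)        = x∈p∪q⁺ (inj₂ (x∈p∪q⁺ (inj₂ i∈)))

  r-fullArms-halfArms-lower : ∀ Z → s + t ≤ m →
            (∣ fullArms Z ∣ + ∣ halfArms Z ∣) ⊓ (m ∸ (t ∸ 1)) + ∣ fullArms Z ∣ ⊓ (s ∸ 1) ≤ r Z
  r-fullArms-halfArms-lower Z s+t≤m =
    lower (subset-of-size (fullArms Z) (m⊓n≤m a L)) (subset-of-size (halfArms Z) (m⊓n≤m c (L ∸ a ⊓ L)))
    where
    a c L σ : ℕ
    a = ∣ fullArms Z ∣
    c = ∣ halfArms Z ∣
    L = m ∸ (t ∸ 1)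
    σ = s ∸ 1
    σ≤L : σ ≤ L
    σ≤L = m+n≤o⇒m≤o∸n σ (≤-trans (+-mono-≤ (m∸n≤m s 1) (m∸n≤m t 1)) s+t≤m)
    bound : a ⊓ L + c ⊓ (L ∸ a ⊓ L) + (t ∸ 1) ≤ m
    bound = ≤-trans (+-monoˡ-≤ (t ∸ 1) (≤-trans (≤-reflexive (⊓-capped-+ a c L)) (m⊓n≤n (a + c) L)))
                    (≤-reflexive (m∸n+n≡m (≤-trans (m∸n≤m t 1) t≤m)))
    lower : (∃[ F ] F ⊆ fullArms Z × ∣ F ∣ ≡ a ⊓ L) → (∃[ H ] H ⊆ halfArms Z × ∣ H ∣ ≡ c ⊓ (L ∸ a ⊓ L)) →
            (a + c) ⊓ L + a ⊓ σ ≤ r Z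
    lower (F , F⊆full , ∣F∣≡f) (H , H⊆half , ∣H∣≡g) = begin
      (a + c) ⊓ L + a ⊓ σ                            ≡⟨ cong₂ _+_ (⊓-capped-+ a c L) (⊓-absorbs-≤ a σ≤L) ⟨
      a ⊓ L + c ⊓ (L ∸ a ⊓ L) + (a ⊓ L) ⊓ σ          ≤⟨ r-FullHalf-lower (a ⊓ L) (c ⊓ (L ∸ a ⊓ L)) ∣F∣≡f ∣H∣≡g bound fullHalf ⟩
      r (Z ∩ U (F ∪ H))                              ≤⟨ r-mono (p∩q⊆p Z (U (F ∪ H))) ⟩
      r Z                                            ∎
      where
      open ≤-Reasoning
      half : ∀ {i} → i ∈ H → ∃[ x ] x ∈ Z ∩ U (F ∪ H) × arm x ≡ i
      half i∈H with halfArms-element Z (H⊆half i∈H)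
      ... | x , x∈Z , refl = x , x∈p∩q⁺ (x∈Z , x∈armsUnion⁺ (x∈p∪q⁺ {p = F} (inj₂ i∈H))) , refl
      fullHalf : FullHalf F H (Z ∩ U (F ∪ H))
      fullHalf = record
        { disjoint = λ i∈F i∈H → fullArms∉halfArms Z (F⊆full i∈F) (H⊆half i∈H)
        ; full⊆    = λ x∈UF → let ax∈F = x∈armsUnion⁻ F x∈UF in
                       x∈p∩q⁺ ( armsUnion-fullArms⊆ Z (x∈armsUnion⁺ (F⊆full ax∈F))
                              , x∈armsUnion⁺ (x∈p∪q⁺ {q = H} (inj₁ ax∈F)))
        ; ⊆arms    = λ x∈ → x∈armsUnion⁻ (F ∪ H) (proj₂ (x∈p∩q⁻ Z _ x∈))
        ; half     = half
        ; unique   = λ x∈ y∈ ax≡ay ax∈H →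
                       halfArms-unique Z (proj₁ (x∈p∩q⁻ Z _ x∈)) (proj₁ (x∈p∩q⁻ Z _ y∈)) ax≡ay (H⊆half ax∈H)
        }

  conn-lower : ∀ {k} Z → s + t ≤ m → 3 * (s ∸ 1) + (t ∸ 1) ≤ m → k ≤ 2 * (s ∸ 1) → k ≤ 2 * (t ∸ 1) →
               k ≤ ∣ Z ∣ → k ≤ ∣ ∁ Z ∣ → k ≤ conn M Z
  conn-lower {k} Z s+t≤m 3σ+τ≤m k≤2σ k≤2τ k≤∣Z∣ k≤∣∁Z∣ = m+n≤o⇒m≤o∸n k (begin
    k + r ⊤                                       ≤⟨ +-monoʳ-≤ k r⊤≤L+σ ⟩
    k + (L + σ)                                   ≤⟨ separation-inequality {k} {σ} {τ} {L} {a} {b} {c}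
                                                       3σ≤L L+τ≤a+b+c k≤2σ k≤2τ k≤2a+c k≤2b+c ⟩
    ((a + c) ⊓ L + a ⊓ σ) + ((b + c) ⊓ L + b ⊓ σ) ≤⟨ +-mono-≤ (r-fullArms-halfArms-lower Z s+t≤m) r∁Z≥ ⟩
    r Z + r (∁ Z)                                 ∎)
    where
    open ≤-Reasoning
    σ τ L a b c : ℕ
    σ = s ∸ 1
    τ = t ∸ 1
    L = m ∸ τ
    a = ∣ fullArms Z ∣
    b = ∣ fullArms (∁ Z) ∣
    c = ∣ halfArms Z ∣
    τ≤m : τ ≤ m
    τ≤m = ≤-trans (m∸n≤m t 1) t≤m
    3σ≤L : 3 * σ ≤ L
    3σ≤L = m+n≤o⇒m≤o∸n (3 * σ) 3σ+τ≤m
    L+τ≤a+b+c : L + τ ≤ a + b + c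
    L+τ≤a+b+c = begin
      L + τ       ≡⟨ m∸n+n≡m τ≤m ⟩
      m           ≤⟨ m≤∣fullArms∣+∣halfArms∣+∣fullArms∁∣ Z ⟩
      a + c + b   ≡⟨ xy∙z≈xz∙y a c b ⟩
      a + b + c   ∎
    k≤2a+c : k ≤ a * 2 + c
    k≤2a+c = ≤-trans k≤∣Z∣ (∣Z∣≤∣fullArms∣*2+∣halfArms∣ Z)
    k≤2b+c : k ≤ b * 2 + c
    k≤2b+c = ≤-trans k≤∣∁Z∣
      (subst (λ H → ∣ ∁ Z ∣ ≤ b * 2 + ∣ H ∣) (halfArms-∁ Z) (∣Z∣≤∣fullArms∣*2+∣halfArms∣ (∁ Z)))
    r∁Z≥ : (b + c) ⊓ L + b ⊓ σ ≤ r (∁ Z)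
    r∁Z≥ = subst (λ H → (b + ∣ H ∣) ⊓ L + b ⊓ σ ≤ r (∁ Z)) (halfArms-∁ Z) (r-fullArms-halfArms-lower (∁ Z) s+t≤m)
    r⊤≤L+σ : r ⊤ ≤ L + σ
    r⊤≤L+σ = +-cancelʳ-≤ t (r ⊤) (L + σ) (begin
      r ⊤ + t       ≤⟨ r-⊤-upper s+t≤m ⟩
      m + s         ≡⟨ cong₂ _+_ (m∸n+n≡m τ≤m) (m∸n+n≡m 1≤s) ⟨
      L + τ + (σ + 1) ≡⟨ interchange L τ σ 1 ⟩
      L + σ + (τ + 1) ≡⟨ cong (L + σ +_) (m∸n+n≡m 1≤t) ⟩
      L + σ + t     ∎)

theorem5p8 : (s t : ℕ) → 2 ≤ s → 2 ≤ t →
    (n m : ℕ) (M : Matroid n) (arm : Fin n → Fin m) →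
    IsSpike M s t m arm →
    ((3 * s + t) ⊔ (s + 3 * t)) ∸ 4 ≤ m →
    IsConnected M (2 * (s ⊓ t) ∸ 1)
theorem5p8 s t 2≤s 2≤t _ _ _ _ spike bound k _ k<2[s⊓t]∸1 X (k≤∣X∣ , k≤∣∁X∣ , conn<k)
  with order-bounds 2≤s 2≤t bound | k≤2[s∸1] (≤-trans (s≤s z≤n) 2≤s) (≤-trans (s≤s z≤n) 2≤t) k<2[s⊓t]∸1
... | s+t≤m , 3σ+τ≤m | k≤2σ , k≤2τ =
  <⇒≱ conn<k (SpikeFacts.conn-lower spike X s+t≤m 3σ+τ≤m k≤2σ k≤2τ k≤∣X∣ k≤∣∁X∣)
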